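{- Let $Q$ be a quiver, $G$ a multigraph, and $\phi:U(Q)\to G$ a morphism in $\mathfrak{M}$. Then there is a unique quiver morphism $\hat\phi:Q\to\overrightarrow{D}(G)$ such that $\theta_G\circ U(\hat\phi)=\phi$.
   Context: A quiver $Q$ consists of sets $\overrightarrow{V}(Q)$, $\overrightarrow{E}(Q)$ and functions $\sigma_Q,\tau_Q:\overrightarrow{E}(Q)\to\overrightarrow{V}(Q)$; morphisms are pairs of functions on vertices and edges commuting with $\sigma$ and $\tau$ (category $\mathfrak{Q}$). A set-system hypergraph $G$ consists of sets $V(G)$, $E(G)$ and $\epsilon_G:E(G)\to\mathcal{P}(V(G))$; morphisms are pairs $(E(\phi),V(\phi))$ with $\epsilon_H\circ E(\phi)=\mathcal{P}V(\phi)\circ\epsilon_G$ ($\mathcal{P}f(A)$ the image). A multigraph is a set-system hypergraph with $1\le|\epsilon_G(e)|\le2$ for all $e$; $\mathfrak{M}$ is the full subcategory of multigraphs. The functor $U:\mathfrak{Q}\to\mathfrak{M}$ sends $Q$ to the multigraph with vertex set $\overrightarrow{V}(Q)$, edge set $\overrightarrow{E}(Q)$ and $\epsilon_{U(Q)}(e)=\{\sigma_Q(e),\tau_Q(e)\}$, and is the identity on the underlying functions of morphisms. For a multigraph $G$, $\overrightarrow{D}(G)$ is the quiver with vertex set $V(G)$, edge set $\{(e,v,w):\epsilon_G(e)=\{v,w\},v\ne w\}\cup\{(e,v,v):\epsilon_G(e)=\{v\}\}$, source $(e,v,w)\mapsto v$ and target $(e,v,w)\mapsto w$. The morphism $\theta_G:U\overrightarrow{D}(G)\to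 G$ is the identity on vertices and $(e,v,w)\mapsto e$ on edges. -}

module Defs where

open import Data.Product using (Σ; Σ-syntax; ∃₂; _×_; _,_; proj₁; proj₂)
open import Data.Sum using (_⊎_; inj₁; inj₂)
open import Relation.Binary.PropositionalEquality
  using (_≡_; refl; sym; trans; cong)

Subset : Set → Set₁
Subset V = V → Set

_≐_ : {V : Set} → Subset V → Subset V → Set
A ≐ B = (∀ x → A x → B x) × (∀ x → B x → A x)

≐-sym : {V : Set} {A B : Subset V} → A ≐ B → B ≐ A
≐-sym (f , g) = g , f

≐-trans : {V : Set} {A B C : Subset V} → A ≐ B → B ≐ C → A ≐ C
≐-trans (f , g) (h , k) = (λ x a → h x (f x a)) , (λ x c → g x (k x c))

image : {V W : Set} → (V → W) → Subset V → Subset W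
image {V} f A y = Σ[ x ∈ V ] (A x × f x ≡ y)

pair : {V : Set} → V → V → Subset V
pair v w x = (x ≡ v) ⊎ (x ≡ w)

image-cong : {V W : Set} (f : V → W) {A B : Subset V} → A ≐ B → image f A ≐ image f B
image-cong f (g , h) = (λ y → λ { (x , a , e) → x , g x a , e })
                     , (λ y → λ { (x , b , e) → x , h x b , e })

image-comp : {U V W : Set} (f : U → V) (g : V → W) (A : Subset U) →
             image g (image f A) ≐ image (λ x → g (f x)) A
image-comp f g A =
  (λ y → λ { (._ , (x , a , refl) , e) → x , a , e })
  , (λ y → λ { (x , a , e) → f x , (x , a , refl) , e })

image-pair : {V W : Set} (f : V → W) (a b : V) → image f (pair a b) ≐ pair (f a) (f b)
image-pair f a b =
  (λ y → λ { (x , inj₁ refl , e) → inj₁ (sym e)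
           ; (x , inj₂ refl , e) → inj₂ (sym e) })
  , (λ y → λ { (inj₁ e) → a , inj₁ refl , sym e
             ; (inj₂ e) → b , inj₂ refl , sym e })

pair-cong : {V : Set} {a a' b b' : V} → a ≡ a' → b ≡ b' → pair a b ≐ pair a' b'
pair-cong refl refl = (λ x p → p) , (λ x p → p)

record Quiver : Set₁ where
  field
    V : Set
    E : Set
    σ : E → V
    τ : E → V

record QuiverHom (Q R : Quiver) : Set where
  private
    module Q = Quiver Q
    module R = Quiver R
  field
    vmap : Q.V → R.V
    emap : Q.E → R.E
    σ-comm : ∀ e → R.σ (emap e) ≡ vmap (Q.σ e)
    τ-comm : ∀ e → R.τ (emap e) ≡ vmap (Q.τ e)

record Hypergraph : Set₁ where
  field
    V : Set
    E : Set
    ε : E → Subset V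

record HypHom (G H : Hypergraph) : Set where
  private
    module G = Hypergraph G
    module H = Hypergraph H
  field
    vmap : G.V → H.V
    emap : G.E → H.E
    comm : ∀ e → H.ε (emap e) ≐ image vmap (G.ε e)

_∘ₕ_ : {G H K : Hypergraph} → HypHom H K → HypHom G H → HypHom G K
_∘ₕ_ {G} {H} {K} g f = record
  { vmap = λ x → g.vmap (f.vmap x)
  ; emap = λ e → g.emap (f.emap e)
  ; comm = λ e → ≐-trans (g.comm (f.emap e))
                  (≐-trans (image-cong g.vmap (f.comm e))
                           (image-comp f.vmap g.vmap (Hypergraph.ε G e)))
  }
  where
    module g = HypHom g
    module f = HypHom f

_≈ₕ_ : {G H : Hypergraph} → HypHom G H → HypHom G H → Set
f ≈ₕ g = (∀ x → HypHom.vmap f x ≡ HypHom.vmap g x)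
       × (∀ e → HypHom.emap f e ≡ HypHom.emap g e)

-- Multigraphs: 1 ≤ |ε(e)| ≤ 2, i.e. ε(e) = {v , w} for some v, w

IsMultigraph : Hypergraph → Set
IsMultigraph G = ∀ e → ∃₂ λ v w → ε e ≐ pair v w
  where open Hypergraph G

record Multigraph : Set₁ where
  field
    graph : Hypergraph
    isMultigraph : IsMultigraph graph

open Multigraph public

-- morphisms in 𝔐 (full subcategory)
MHom : Multigraph → Multigraph → Set
MHom G H = HypHom (graph G) (graph H)

U : Quiver → Multigraph
U Q = record
  { graph = record { V = Q.V ; E = Q.E ; ε = λ e → pair (Q.σ e) (Q.τ e) }
  ; isMultigraph = λ e → Q.σ e , Q.τ e , ((λ x p → p) , (λ x p → p))
  }
  where module Q = Quiver Q

Uₕ : {Q R : Quiver} → QuiverHom Q R → MHom (U Q) (U R)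
Uₕ {Q} {R} f = record
  { vmap = f.vmap
  ; emap = f.emap
  ; comm = λ e → ≐-trans (pair-cong (f.σ-comm e) (f.τ-comm e))
                         (≐-sym (image-pair f.vmap (Quiver.σ Q e) (Quiver.τ Q e)))
  }
  where module f = QuiverHom f

D : Multigraph → Quiver
D G = record
  { V = H.V
  ; E = Σ[ e ∈ H.E ] Σ[ v ∈ H.V ] Σ[ w ∈ H.V ] (H.ε e ≐ pair v w)
  ; σ = λ t → proj₁ (proj₂ t)
  ; τ = λ t → proj₁ (proj₂ (proj₂ t))
  }
  where module H = Hypergraph (graph G)

θ : (G : Multigraph) → MHom (U (D G)) G
θ G = record
  { vmap = λ x → x
  ; emap = λ t → proj₁ t
  ; comm = λ { (e , v , w , p) → ≐-trans p (≐-sym (image-pair (λ x → x) v w)) }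
  }

_≈D_ : {Q : Quiver} {G : Multigraph} → QuiverHom Q (D G) → QuiverHom Q (D G) → Set
_≈D_ {Q} f g =
    (∀ x → QuiverHom.vmap f x ≡ QuiverHom.vmap g x)
  × (∀ a → (proj₁ (QuiverHom.emap f a) ≡ proj₁ (QuiverHom.emap g a))
         × (proj₁ (proj₂ (QuiverHom.emap f a)) ≡ proj₁ (proj₂ (QuiverHom.emap g a)))
         × (proj₁ (proj₂ (proj₂ (QuiverHom.emap f a))) ≡ proj₁ (proj₂ (proj₂ (QuiverHom.emap g a)))))

-- A morphism φ : U(Q) → G sends each arrow a : x → y of Q to an edge φ(a)
-- of G whose end-set is the image {φ(x), φ(y)} of {x, y}.  Hence the triple
-- (φ(a), φ(x), φ(y)) is an edge of D(G) running from φ(x) to φ(y), and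
-- a ↦ (φ(a), φ(x), φ(y)) together with φ on vertices is a quiver morphism
-- φ̂ : Q → D(G) (the lift).  Since θ_G forgets the endpoints, θ_G ∘ U(φ̂)
-- and φ have literally the same underlying functions.
--
-- Uniqueness: if θ_G ∘ U(ψ) = φ, then ψ agrees with φ on vertices and its
-- edge triples have first component φ(a); their endpoints are forced by the
-- quiver-morphism equations of ψ, namely σ(ψ(a)) = ψ(σ a) = φ(σ a), and
-- similarly for τ.
module Submission where

open import Defs
open import Data.Product using (Σ; Σ-syntax; _×_; _,_)
open import Relation.Binary.PropositionalEquality using (_≡_; refl; trans)

lift : {Q : Quiver} {G : Multigraph} → MHom (U Q) G → QuiverHom Q (D G)
lift {Q} {G} φ = record
  { vmap   = φ.vmap
  ; emap   = λ a → φ.emap a , φ.vmap (Q.σ a) , φ.vmap (Q.τ a)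
                 , ≐-trans (φ.comm a) (image-pair φ.vmap (Q.σ a) (Q.τ a))
  ; σ-comm = λ a → refl
  ; τ-comm = λ a → refl
  }
  where
    module Q = Quiver Q
    module φ = HypHom φ

lift-factors : {Q : Quiver} {G : Multigraph} (φ : MHom (U Q) G) →
               (θ G ∘ₕ Uₕ (lift {Q} {G} φ)) ≈ₕ φ
lift-factors φ = (λ x → refl) , (λ a → refl)

-- Uniqueness: a quiver morphism ψ with θ_G ∘ U(ψ) = φ agrees with the lift;
-- the endpoints of ψ(a) are pinned down by ψ commuting with σ and τ.
lift-unique : {Q : Quiver} {G : Multigraph} (φ : MHom (U Q) G)
              (ψ : QuiverHom Q (D G)) → (θ G ∘ₕ Uₕ ψ) ≈ₕ φ →
              _≈D_ {Q} {G} ψ (lift {Q} {G} φ)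
lift-unique {Q} φ ψ (same-vertices , same-edges) =
  same-vertices , λ a → same-edges a
                      , trans (ψ.σ-comm a) (same-vertices (Q.σ a))
                      , trans (ψ.τ-comm a) (same-vertices (Q.τ a))
  where
    module Q = Quiver Q
    module ψ = QuiverHom ψ

mainTheorem10 : (Q : Quiver) (G : Multigraph) (φ : MHom (U Q) G) →
    Σ[ φ̂ ∈ QuiverHom Q (D G) ]
      (((θ G ∘ₕ Uₕ φ̂) ≈ₕ φ)
      × (∀ (ψ : QuiverHom Q (D G)) → (θ G ∘ₕ Uₕ ψ) ≈ₕ φ → _≈D_ {Q} {G} ψ φ̂))
mainTheorem10 Q G φ = lift {Q} {G} φ , lift-factors {Q} {G} φ , lift-unique {Q} {G} φ
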